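{- Let $G=(V,E,w)$ be a connected undirected graph with positive edge weights, and let $K=\{t_1,\dots,t_k\}\subseteq V$ with $k\ge2$. For every outcome of the random choices, and regardless of how the arbitrary choices are made, the sets $V_1,\dots,V_k$ constructed by the Noisy-Voronoi algorithm (described in the context) form a terminal partition of $V$.
   Context: $d_G$ is the shortest-path metric of $G$. For $v\in V$ let $D(v)=\min_{t\in K}d_G(v,t)$. A terminal partition is a partition $\{V_1,\dots,V_k\}$ of $V$ with $t_i\in V_i$ and $G[V_i]$ connected for every $i$. Noisy-Voronoi algorithm: set $\delta=\frac{1}{20\ln k}$, $p=\frac15$, and $V_\perp\leftarrow V\setminus K$. For $j=1,\dots,k$ in this order: sample $g_j\sim\mathsf{Geo}(p)$ independently, where $\Pr[g_j=s]=(1-p)^{s-1}p$ for $s\ge1$; set $R_j=(1+\delta)^{g_j}$; compute $V_j=\texttt{Create-Cluster}(V_\perp,t_j,R_j)$; and remove $V_j$ from $V_\perp$. $\texttt{Create-Cluster}(V_\perp,t_j,R_j)$: set $V_j\leftarrow\{t_j\}$, $U\leftarrow\emptyset$, and $N\leftarrow$ the set of neighbors of $t_j$ in $V_\perp$. While $N\ne\emptyset$: remove an arbitrary $v$ from $N$. If $d_G(v,t_j)\le R_j\cdot D(v)$, add $v$ to $V_j$ and add to $N$ all neighbors of $v$ in $V_\perp\setminus(U\cup V_j)$; otherwise add $v$ to $U$. Return $V_j$. -}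

module Defs where

open import Level using (0ℓ)
open import Data.Nat as ℕ using (ℕ; zero; suc)
open import Data.Bool using (Bool; true; false; _∧_)
open import Data.Fin using (Fin; _<?_)
open import Data.Fin.Subset using (Subset; _∈_; _∉_; ⊥; ⊤; ⁅_⁆; _∪_; _─_; ⋃)
open import Data.List using (List; []; _∷_; map; filter; allFin)
open import Data.Vec using (tabulate; lookup)
open import Data.Product using (Σ; ∃; _×_; _,_)
open import Relation.Nullary using (¬_)
open import Relation.Binary.PropositionalEquality using (_≡_)
open import Relation.Binary.Structures using (IsTotalOrder)
open import Algebra.Structures using (IsCommutativeRing)

-- We work over an
-- arbitrary ordered field equipped with a logarithm function that is
-- strictly increasing on the positives and satisfies ln 1 = 0.  The real
-- numbers (with the natural logarithm) are a model, so the statement for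
-- every such structure contains the statement over ℝ.

record RealLike : Set₁ where
  infixl 6 _+_
  infixl 7 _*_
  infix  4 _≤_ _<_
  field
    ℝ    : Set
    _+_  : ℝ → ℝ → ℝ
    _*_  : ℝ → ℝ → ℝ
    -_   : ℝ → ℝ
    0ℝ   : ℝ
    1ℝ   : ℝ
    _⁻¹  : ℝ → ℝ
    _≤_  : ℝ → ℝ → Set
    ln   : ℝ → ℝ
    isCommutativeRing : IsCommutativeRing _≡_ _+_ _*_ -_ 0ℝ 1ℝ
    0≢1          : ¬ (0ℝ ≡ 1ℝ)
    ⁻¹-inverse   : ∀ x → ¬ (x ≡ 0ℝ) → x * (x ⁻¹) ≡ 1ℝ
    ≤-isTotalOrder : IsTotalOrder _≡_ _≤_
    +-mono-≤     : ∀ {x y} z → x ≤ y → x + z ≤ y + z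
    *-nonneg     : ∀ {x y} → 0ℝ ≤ x → 0ℝ ≤ y → 0ℝ ≤ x * y

  _<_ : ℝ → ℝ → Set
  x < y = x ≤ y × ¬ (x ≡ y)

  field
    ln-1          : ln 1ℝ ≡ 0ℝ
    ln-strictMono : ∀ {x y} → 0ℝ < x → x < y → ln x < ln y

  fromℕ : ℕ → ℝ
  fromℕ zero    = 0ℝ
  fromℕ (suc m) = 1ℝ + fromℕ m

  _^_ : ℝ → ℕ → ℝ
  x ^ zero  = 1ℝ
  x ^ suc m = x * (x ^ m)

module Graphs (F : RealLike) where
  open RealLike F

  record WGraph (n : ℕ) : Set where
    field
      adj     : Fin n → Fin n → Bool
      adj-sym : ∀ u v → adj u v ≡ adj v u
      w       : Fin n → Fin n → ℝ
      w-sym   : ∀ u v → w u v ≡ w v u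
      w-pos   : ∀ u v → adj u v ≡ true → 0ℝ < w u v

  module _ {n : ℕ} (G : WGraph n) where
    open WGraph G

    data Walk : Fin n → Fin n → Set where
      [] : ∀ {v} → Walk v v
      step : ∀ {u v x} → adj u v ≡ true → Walk v x → Walk u x

    weight : ∀ {u v} → Walk u v → ℝ
    weight [] = 0ℝ
    weight (step {u} {v} _ p) = w u v + weight p

    WalkIn : Subset n → ∀ {u v} → Walk u v → Set
    WalkIn S {u} [] = u ∈ S
    WalkIn S {u} (step _ p) = u ∈ S × WalkIn S p

    Connected : Set
    Connected = ∀ u v → Walk u v

    IsShortestPathMetric : (Fin n → Fin n → ℝ) → Set
    IsShortestPathMetric d = ∀ u v →
      (Σ (Walk u v) λ p → weight p ≡ d u v) × (∀ (p : Walk u v) → d u v ≤ weight p)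

    IsTerminalDistance : ∀ {k} → (Fin k → Fin n) → (Fin n → Fin n → ℝ) → (Fin n → ℝ) → Set
    IsTerminalDistance t d D = ∀ v →
      (∃ λ i → D v ≡ d v (t i)) × (∀ i → D v ≤ d v (t i))

    nbrs : Fin n → Subset n → Subset n
    nbrs v S = tabulate λ u → adj v u ∧ lookup S u

    -- Nondeterministic execution of Create-Cluster(V⊥, tj, R), with the
    -- given d and D.  CCRun V⊥ tj R N U Vj res : starting the while-loop
    -- in state (N, U, Vj), some sequence of arbitrary choices ends with
    -- returned set res.
    module _ (d : Fin n → Fin n → ℝ) (D : Fin n → ℝ) where
      data CCRun (V⊥ : Subset n) (tj : Fin n) (R : ℝ) :
                 Subset n → Subset n → Subset n → Subset n → Set where
        done   : ∀ {U Vj} → CCRun V⊥ tj R ⊥ U Vj Vj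
        accept : ∀ {N U Vj res} (v : Fin n) → v ∈ N →
                 d v tj ≤ R * D v →
                 CCRun V⊥ tj R ((N ─ ⁅ v ⁆) ∪ nbrs v (V⊥ ─ (U ∪ (Vj ∪ ⁅ v ⁆))))
                               U (Vj ∪ ⁅ v ⁆) res →
                 CCRun V⊥ tj R N U Vj res
        reject : ∀ {N U Vj res} (v : Fin n) → v ∈ N →
                 ¬ (d v tj ≤ R * D v) →
                 CCRun V⊥ tj R (N ─ ⁅ v ⁆) (U ∪ ⁅ v ⁆) Vj res →
                 CCRun V⊥ tj R N U Vj res

      CreateCluster : Subset n → Fin n → ℝ → Subset n → Set
      CreateCluster V⊥ tj R res = CCRun V⊥ tj R (nbrs tj V⊥) ⊥ ⁅ tj ⁆ res

      module _ {k : ℕ} (t : Fin k → Fin n) where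
        Kset : Subset n
        Kset = ⋃ (map (λ i → ⁅ t i ⁆) (allFin k))

        Vbot : (Fin k → Subset n) → Fin k → Subset n
        Vbot C j = (⊤ ─ Kset) ─ ⋃ (map C (filter (λ i → i <? j) (allFin k)))

        δ : ℝ
        δ = (fromℕ 20 * ln (fromℕ k)) ⁻¹

        Radius : ℕ → ℝ
        Radius g = (1ℝ + δ) ^ g

        -- C = (V_1,…,V_k) is a possible output of Noisy-Voronoi when the
        -- geometric samples are g_1,…,g_k
        NoisyVoronoiRun : (Fin k → ℕ) → (Fin k → Subset n) → Set
        NoisyVoronoiRun g C = ∀ j → CreateCluster (Vbot C j) (t j) (Radius (g j)) (C j)

        IsTerminalPartition : (Fin k → Subset n) → Set
        IsTerminalPartition C =
          (∀ i → t i ∈ C i) ×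
          (∀ v → ∃ λ i → v ∈ C i) ×
          (∀ i i' v → v ∈ C i → v ∈ C i' → i ≡ i') ×
          (∀ i u v → u ∈ C i → v ∈ C i → Σ (Walk u v) (WalkIn (C i)))

module Submission where

-- Create-Cluster maintains an invariant: the accepted set V_j contains t_j, each member is
-- joined to t_j by a walk inside V_j and is t_j or passed the test d(v,t_j) ≤ R_j D(v), the
-- rejected set failed the test, and each V⊥-neighbour of V_j is pending, rejected or accepted.
-- On termination V_j is therefore connected and closed: a V⊥-neighbour of V_j outside V_j fails
-- the test.  As V_j ⊆ {t_j} ∪ V⊥ and V⊥ avoids terminals and earlier clusters, the V_j are
-- disjoint.  For coverage, walk backwards along a shortest path from v to its nearest terminal:
-- if the successor x of y lies in V_i but y lies in no cluster, then y was in V⊥ at step i and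
-- d(y,t_i) ≤ w(y,x) + R_i D(x) ≤ R_i (w(y,x) + D(x)) ≤ R_i D(y), using R_i ≥ 1, so y would
-- have been accepted into V_i.

open import Defs
open import Data.Nat using (ℕ; _≤_)
open import Data.Fin using (Fin)
open import Data.Fin.Subset using (Subset)
open import Function.Definitions using (Injective)
open import Relation.Binary.PropositionalEquality using (_≡_)

open import Algebra.Bundles using (CommutativeRing)
open import Algebra.Structures using (IsCommutativeRing)
import Algebra.Properties.Group as GroupProperties
import Algebra.Properties.Ring as RingProperties
open import Data.Bool using (true; _∧_)
open import Data.Bool.Properties using (∧-conicalˡ; ∧-conicalʳ)
open import Data.Empty using (⊥-elim)
open import Function using (_∘_)
open import Data.Fin using (_≟_; _<?_)
import Data.Fin as Fin
open import Data.Fin.Properties using (any?; <-cmp)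
open import Data.Fin.Subset using (inside; _∈_; _∉_; ⊥; ⁅_⁆; _∪_; _─_; ⋃; _⊆_)
open import Data.Fin.Subset.Properties
  using (_∈?_; ∉⊥; ∈⊤; x∈⁅x⁆; x∈⁅y⁆⇒x≡y; x≢y⇒x∉⁅y⁆; x∈p∪q⁻; p⊆p∪q; q⊆p∪q;
         x∈p∧x∉q⇒x∈p─q; p─q⊆p)
open import Data.List using (List; []; _∷_; map; filter; allFin)
import Data.List.Membership.Propositional as List
open import Data.List.Membership.Propositional.Properties using (∈-filter⁺; ∈-allFin)
open import Data.List.Relation.Unary.Any using (here; there)
open import Data.Nat using (zero; suc; s≤s)
open import Data.Product using (Σ; ∃; _×_; _,_; proj₁; proj₂)
open import Data.Sum using (_⊎_; inj₁; inj₂)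
open import Data.Vec using (_∷_; lookup)
import Data.Vec as Vec
open import Data.Vec.Properties using (lookup∘tabulate; []=⇒lookup; lookup⇒[]=)
open import Relation.Binary.Definitions using (tri<; tri≈; tri>)
open import Relation.Binary.PropositionalEquality
  using (_≢_; refl; sym; trans; cong; cong₂; subst; subst₂; module ≡-Reasoning)
open import Relation.Binary.Bundles using (Preorder)
open import Relation.Binary.Structures using (IsTotalOrder)
import Relation.Binary.Reasoning.Preorder as PreorderReasoning
open import Relation.Nullary using (¬_; yes; no)

module OrderedFieldProperties (F : RealLike) where
  open RealLike F renaming (_≤_ to _≤ᵣ_)
  open IsCommutativeRing isCommutativeRing
    using (+-comm; +-identityˡ; +-identityʳ; -‿inverseˡ; -‿inverseʳ;
           *-assoc; *-comm; *-identityˡ; *-identityʳ; distribˡ; zeroʳ)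
  open IsTotalOrder ≤-isTotalOrder public
    using (total; isPreorder) renaming (refl to ≤-refl; trans to ≤-trans; antisym to ≤-antisym)

  commutativeRing : CommutativeRing _ _
  commutativeRing = record { isCommutativeRing = isCommutativeRing }

  open CommutativeRing commutativeRing using (ring; +-group)
  open RingProperties ring using (-‿distribˡ-*; -‿distribʳ-*; x[y-z]≈xy-xz)
  open GroupProperties +-group using (\\-leftDividesʳ; //-rightDividesˡ; ⁻¹-involutive; ∙-cancelˡ)

  private variable x y z : ℝ

  preorder : Preorder _ _ _
  preorder = record { isPreorder = isPreorder }

  module ≤-Reasoning = PreorderReasoning preorder

  <-≤-trans : x < y → y ≤ᵣ z → x < z
  <-≤-trans (x≤y , x≢y) y≤z = ≤-trans x≤y y≤z , λ { refl → x≢y (≤-antisym x≤y y≤z) }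

  +-monoʳ-≤ : ∀ z → x ≤ᵣ y → z + x ≤ᵣ z + y
  +-monoʳ-≤ {x} {y} z x≤y = subst₂ _≤ᵣ_ (+-comm x z) (+-comm y z) (+-mono-≤ z x≤y)

  +-cancelˡ-≤ : ∀ z → z + x ≤ᵣ z + y → x ≤ᵣ y
  +-cancelˡ-≤ {x} {y} z le =
    subst₂ _≤ᵣ_ (\\-leftDividesʳ z x) (\\-leftDividesʳ z y) (+-monoʳ-≤ (- z) le)

  x≤x+y : 0ℝ ≤ᵣ y → x ≤ᵣ x + y
  x≤x+y {y} {x} 0≤y = subst (_≤ᵣ x + y) (+-identityʳ x) (+-monoʳ-≤ x 0≤y)

  x<x+y : 0ℝ < y → x < x + y
  x<x+y {y} {x} (0≤y , 0≢y) = x≤x+y 0≤y , λ x≡x+y →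
    0≢y (∙-cancelˡ x 0ℝ y (trans (+-identityʳ x) x≡x+y))

  +-nonneg : 0ℝ ≤ᵣ x → 0ℝ ≤ᵣ y → 0ℝ ≤ᵣ x + y
  +-nonneg {x} 0≤x 0≤y = ≤-trans 0≤x (x≤x+y 0≤y)

  x≤y⇒0≤y-x : x ≤ᵣ y → 0ℝ ≤ᵣ y + - x
  x≤y⇒0≤y-x {x} x≤y = subst (_≤ᵣ _) (-‿inverseʳ x) (+-mono-≤ (- x) x≤y)

  x≤0⇒0≤-x : x ≤ᵣ 0ℝ → 0ℝ ≤ᵣ - x
  x≤0⇒0≤-x {x} x≤0 = subst (0ℝ ≤ᵣ_) (+-identityˡ (- x)) (x≤y⇒0≤y-x x≤0)

  *-monoˡ-≤ : 0ℝ ≤ᵣ z → x ≤ᵣ y → z * x ≤ᵣ z * y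
  *-monoˡ-≤ {z} {x} {y} 0≤z x≤y =
    subst₂ _≤ᵣ_ (+-identityˡ (z * x)) (//-rightDividesˡ (z * x) (z * y)) (+-mono-≤ (z * x) 0≤zy-zx)
    where
    0≤zy-zx : 0ℝ ≤ᵣ z * y + - (z * x)
    0≤zy-zx = subst (0ℝ ≤ᵣ_) (x[y-z]≈xy-xz z y x) (*-nonneg 0≤z (x≤y⇒0≤y-x x≤y))

  0≤x*x : ∀ x → 0ℝ ≤ᵣ x * x
  0≤x*x x with total 0ℝ x
  ... | inj₁ 0≤x = *-nonneg 0≤x 0≤x
  ... | inj₂ x≤0 = subst (0ℝ ≤ᵣ_) -x*-x≡x*x (*-nonneg (x≤0⇒0≤-x x≤0) (x≤0⇒0≤-x x≤0))
    where
    open ≡-Reasoning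
    -x*-x≡x*x : - x * - x ≡ x * x
    -x*-x≡x*x = begin
      - x * - x     ≡⟨ -‿distribˡ-* x (- x) ⟨
      - (x * - x)   ≡⟨ cong -_ (-‿distribʳ-* x x) ⟨
      - - (x * x)   ≡⟨ ⁻¹-involutive (x * x) ⟩
      x * x         ∎

  0≤1 : 0ℝ ≤ᵣ 1ℝ
  0≤1 = subst (0ℝ ≤ᵣ_) (*-identityʳ 1ℝ) (0≤x*x 1ℝ)

  0<1 : 0ℝ < 1ℝ
  0<1 = 0≤1 , 0≢1

  0≰-1 : ¬ (0ℝ ≤ᵣ - 1ℝ)
  0≰-1 0≤-1 = 0≢1 (≤-antisym 0≤1 1≤0)
    where
    1≤0 : 1ℝ ≤ᵣ 0ℝ
    1≤0 = subst₂ _≤ᵣ_ (+-identityˡ 1ℝ) (-‿inverseˡ 1ℝ) (+-mono-≤ 1ℝ 0≤-1)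

  *-pos : 0ℝ < x → 0ℝ < y → 0ℝ < x * y
  *-pos {x} {y} (0≤x , 0≢x) (0≤y , 0≢y) = *-nonneg 0≤x 0≤y , λ 0≡xy → 0≢y (sym (begin
    y                 ≡⟨ *-identityˡ y ⟨
    1ℝ * y            ≡⟨ cong (_* y) x⁻¹*x≡1 ⟨
    x ⁻¹ * x * y      ≡⟨ *-assoc (x ⁻¹) x y ⟩
    x ⁻¹ * (x * y)    ≡⟨ cong (x ⁻¹ *_) 0≡xy ⟨
    x ⁻¹ * 0ℝ         ≡⟨ zeroʳ (x ⁻¹) ⟩
    0ℝ                ∎))
    where
    open ≡-Reasoning
    x⁻¹*x≡1 : x ⁻¹ * x ≡ 1ℝ
    x⁻¹*x≡1 = trans (*-comm (x ⁻¹) x) (⁻¹-inverse x (λ x≡0 → 0≢x (sym x≡0)))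

  ⁻¹-nonneg : 0ℝ < x → 0ℝ ≤ᵣ x ⁻¹
  ⁻¹-nonneg {x} (0≤x , 0≢x) with total 0ℝ (x ⁻¹)
  ... | inj₁ 0≤x⁻¹ = 0≤x⁻¹
  ... | inj₂ x⁻¹≤0 = ⊥-elim (0≰-1 (subst (0ℝ ≤ᵣ_) x*-x⁻¹≡-1 (*-nonneg 0≤x (x≤0⇒0≤-x x⁻¹≤0))))
    where
    x*-x⁻¹≡-1 : x * - (x ⁻¹) ≡ - 1ℝ
    x*-x⁻¹≡-1 = trans (sym (-‿distribʳ-* x (x ⁻¹))) (cong -_ (⁻¹-inverse x (λ x≡0 → 0≢x (sym x≡0))))

  1≤^ : 1ℝ ≤ᵣ x → ∀ m → 1ℝ ≤ᵣ x ^ m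
  1≤^ 1≤x zero    = ≤-refl
  1≤^ {x} 1≤x (suc m) =
    ≤-trans 1≤x (subst (_≤ᵣ x * x ^ m) (*-identityʳ x) (*-monoˡ-≤ (≤-trans 0≤1 1≤x) (1≤^ 1≤x m)))

  fromℕ-nonneg : ∀ m → 0ℝ ≤ᵣ fromℕ m
  fromℕ-nonneg zero    = ≤-refl
  fromℕ-nonneg (suc m) = +-nonneg 0≤1 (fromℕ-nonneg m)

  fromℕ-suc-pos : ∀ m → 0ℝ < fromℕ (suc m)
  fromℕ-suc-pos m = <-≤-trans 0<1 (x≤x+y (fromℕ-nonneg m))

  ln-pos : 1ℝ < x → 0ℝ < ln x
  ln-pos 1<x with ln-strictMono 0<1 1<x
  ... | ln1≤lnx , ln1≢lnx = subst (_≤ᵣ _) ln-1 ln1≤lnx , λ 0≡lnx → ln1≢lnx (trans ln-1 0≡lnx)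

  δ-nonneg : ∀ {k} → 2 ≤ k → 0ℝ ≤ᵣ (fromℕ 20 * ln (fromℕ k)) ⁻¹
  δ-nonneg {suc (suc k)} (s≤s (s≤s _)) =
    ⁻¹-nonneg (*-pos (fromℕ-suc-pos 19) (ln-pos (x<x+y (fromℕ-suc-pos k))))

  dilate-+-≤ : ∀ {r w a b} → 1ℝ ≤ᵣ r → 0ℝ ≤ᵣ w → w + a ≤ᵣ b → w + r * a ≤ᵣ r * b
  dilate-+-≤ {r} {w} {a} {b} 1≤r 0≤w w+a≤b = begin
    w + r * a        ∼⟨ +-mono-≤ (r * a) w≤rw ⟩
    r * w + r * a    ≡⟨ distribˡ r w a ⟨
    r * (w + a)      ∼⟨ *-monoˡ-≤ (≤-trans 0≤1 1≤r) w+a≤b ⟩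
    r * b            ∎
    where
    open ≤-Reasoning
    w≤rw : w ≤ᵣ r * w
    w≤rw = subst₂ _≤ᵣ_ (*-identityʳ w) (*-comm w r) (*-monoˡ-≤ 0≤w 1≤r)

x∈p─q⇒x∉q : ∀ {n} {x : Fin n} {p q : Subset n} → x ∈ p ─ q → x ∉ q
x∈p─q⇒x∉q {p = _ ∷ _} {inside ∷ _} () Vec.here
x∈p─q⇒x∉q {p = _ ∷ _} {_ ∷ _} (Vec.there x∈p─q) (Vec.there x∈q) = x∈p─q⇒x∉q x∈p─q x∈q

x∈p∪⁅y⁆⁻ : ∀ {n} {x y : Fin n} (p : Subset n) → x ∈ p ∪ ⁅ y ⁆ → x ∈ p ⊎ x ≡ y
x∈p∪⁅y⁆⁻ {y = y} p x∈p∪y with x∈p∪q⁻ p ⁅ y ⁆ x∈p∪y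
... | inj₁ x∈p = inj₁ x∈p
... | inj₂ x∈y = inj₂ (x∈⁅y⁆⇒x≡y y x∈y)

x∈p⇒x∈p-y⊎x≡y : ∀ {n} {x : Fin n} {p : Subset n} y → x ∈ p → x ∈ p ─ ⁅ y ⁆ ⊎ x ≡ y
x∈p⇒x∈p-y⊎x≡y {x = x} y x∈p with x ≟ y
... | yes x≡y = inj₂ x≡y
... | no x≢y  = inj₁ (x∈p∧x∉q⇒x∈p─q x∈p (x≢y⇒x∉⁅y⁆ x≢y))

∈⋃-map⁻ : ∀ {n} {A : Set} (f : A → Subset n) (as : List A) {x} →
          x ∈ ⋃ (map f as) → ∃ λ a → x ∈ f a
∈⋃-map⁻ f []       x∈⋃ = ⊥-elim (∉⊥ x∈⋃)
∈⋃-map⁻ f (a ∷ as) x∈⋃ with x∈p∪q⁻ (f a) _ x∈⋃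
... | inj₁ x∈fa = a , x∈fa
... | inj₂ x∈⋃' = ∈⋃-map⁻ f as x∈⋃'

∈⋃-map⁺ : ∀ {n} {A : Set} (f : A → Subset n) {as : List A} {x a} →
          a List.∈ as → x ∈ f a → x ∈ ⋃ (map f as)
∈⋃-map⁺ f (here refl) x∈fa = p⊆p∪q _ x∈fa
∈⋃-map⁺ f {b ∷ _} (there a∈as) x∈fa = q⊆p∪q (f b) _ (∈⋃-map⁺ f a∈as x∈fa)

module WalkProperties (F : RealLike) {n : ℕ} (G : Graphs.WGraph F n) where
  open RealLike F renaming (_≤_ to _≤ᵣ_)
  open Graphs F
  open WGraph G
  open OrderedFieldProperties F
  private variable u v x : Fin n; S T : Subset n

  adj-flip : adj u v ≡ true → adj v u ≡ true
  adj-flip {u} {v} uv = trans (adj-sym v u) uv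

  _++_ : Walk G u v → Walk G v x → Walk G u x
  []       ++ q = q
  step e p ++ q = step e (p ++ q)

  reverse : Walk G u v → Walk G v u
  reverse []         = []
  reverse (step e p) = reverse p ++ step (adj-flip e) []

  WalkIn-source : (p : Walk G u v) → WalkIn G S p → u ∈ S
  WalkIn-source []         u∈S       = u∈S
  WalkIn-source (step e p) (u∈S , _) = u∈S

  WalkIn-++ : (p : Walk G u v) (q : Walk G v x) → WalkIn G S p → WalkIn G S q → WalkIn G S (p ++ q)
  WalkIn-++ []         q _           q∈S = q∈S
  WalkIn-++ (step e p) q (u∈S , p∈S) q∈S = u∈S , WalkIn-++ p q p∈S q∈S

  WalkIn-reverse : (p : Walk G u v) → WalkIn G S p → WalkIn G S (reverse p)
  WalkIn-reverse []         u∈S         = u∈S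
  WalkIn-reverse (step e p) (u∈S , p∈S) =
    WalkIn-++ (reverse p) (step (adj-flip e) []) (WalkIn-reverse p p∈S) (WalkIn-source p p∈S , u∈S)

  WalkIn-mono : S ⊆ T → (p : Walk G u v) → WalkIn G S p → WalkIn G T p
  WalkIn-mono S⊆T []         u∈S         = S⊆T u∈S
  WalkIn-mono S⊆T (step e p) (u∈S , p∈S) = S⊆T u∈S , WalkIn-mono S⊆T p p∈S

  weight-nonneg : (p : Walk G u v) → 0ℝ ≤ᵣ weight G p
  weight-nonneg []         = ≤-refl
  weight-nonneg (step e p) = +-nonneg (proj₁ (w-pos _ _ e)) (weight-nonneg p)

  ∈nbrs⁻ : ∀ S → u ∈ nbrs G v S → adj v u ≡ true × u ∈ S
  ∈nbrs⁻ {u} {v} S u∈nbrs = ∧-conicalˡ _ _ adj∧S , lookup⇒[]= u S (∧-conicalʳ _ _ adj∧S)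
    where
    adj∧S : (adj v u ∧ lookup S u) ≡ true
    adj∧S = trans (sym (lookup∘tabulate _ u)) ([]=⇒lookup u∈nbrs)

  ∈nbrs⁺ : adj v u ≡ true → u ∈ S → u ∈ nbrs G v S
  ∈nbrs⁺ {v} {u} {S} vu u∈S =
    lookup⇒[]= u _ (trans (lookup∘tabulate _ u) (cong₂ _∧_ vu ([]=⇒lookup u∈S)))

module CreateClusterProperties
  (F : RealLike) {n : ℕ} (G : Graphs.WGraph F n)
  (d : Fin n → Fin n → RealLike.ℝ F) (D : Fin n → RealLike.ℝ F)
  (V⊥ : Subset n) (tj : Fin n) (R : RealLike.ℝ F) where
  open RealLike F renaming (_≤_ to _≤ᵣ_)
  open Graphs F
  open WGraph G
  open WalkProperties F G
  private variable u v x y : Fin n; N U Vj res : Subset n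

  Accepts : Fin n → Set
  Accepts v = d v tj ≤ᵣ R * D v

  record IsGrownCluster (Vj : Subset n) : Set where
    field
      centre∈        : tj ∈ Vj
      reaches-centre : x ∈ Vj → Σ (Walk G x tj) (WalkIn G Vj)
      admitted       : x ∈ Vj → x ≡ tj ⊎ (x ∈ V⊥ × Accepts x)

  record LoopInvariant (N U Vj : Subset n) : Set where
    field
      grown    : IsGrownCluster Vj
      frontier : v ∈ N → v ∈ V⊥ × ∃ λ x → x ∈ Vj × adj x v ≡ true
      rejected : u ∈ U → ¬ Accepts u
      closed   : x ∈ Vj → adj x y ≡ true → y ∈ V⊥ → y ∈ N ⊎ y ∈ U ⊎ y ∈ Vj

  record IsCluster (Vj : Subset n) : Set where
    field
      grown  : IsGrownCluster Vj
      closed : x ∈ Vj → adj x y ≡ true → y ∈ V⊥ → y ∈ Vj ⊎ ¬ Accepts y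
    open IsGrownCluster grown public

  grow : IsGrownCluster Vj → x ∈ Vj → adj x v ≡ true → v ∈ V⊥ → Accepts v →
         IsGrownCluster (Vj ∪ ⁅ v ⁆)
  grow {Vj} {x} {v} C x∈Vj xv v∈V⊥ v-acc = record
    { centre∈ = Vj⊆ centre∈ ; reaches-centre = reaches-centre′ ; admitted = admitted′ }
    where
    open IsGrownCluster C
    Vj⊆ : Vj ⊆ Vj ∪ ⁅ v ⁆
    Vj⊆ = p⊆p∪q ⁅ v ⁆
    reaches-centre′ : y ∈ Vj ∪ ⁅ v ⁆ → Σ (Walk G y tj) (WalkIn G (Vj ∪ ⁅ v ⁆))
    reaches-centre′ y∈ with x∈p∪⁅y⁆⁻ Vj y∈
    ... | inj₁ y∈Vj = let p , p⊆Vj = reaches-centre y∈Vj in p , WalkIn-mono Vj⊆ p p⊆Vj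
    ... | inj₂ refl = let p , p⊆Vj = reaches-centre x∈Vj in
                      step (adj-flip xv) p , y∈ , WalkIn-mono Vj⊆ p p⊆Vj
    admitted′ : y ∈ Vj ∪ ⁅ v ⁆ → y ≡ tj ⊎ (y ∈ V⊥ × Accepts y)
    admitted′ y∈ with x∈p∪⁅y⁆⁻ Vj y∈
    ... | inj₁ y∈Vj = admitted y∈Vj
    ... | inj₂ refl = inj₂ (v∈V⊥ , v-acc)

  accept-step : LoopInvariant N U Vj → v ∈ N → Accepts v →
    LoopInvariant ((N ─ ⁅ v ⁆) ∪ nbrs G v (V⊥ ─ (U ∪ (Vj ∪ ⁅ v ⁆)))) U (Vj ∪ ⁅ v ⁆)
  accept-step {N} {U} {Vj} {v} I v∈N v-acc
    with v∈V⊥ , _ , a∈Vj , av ← LoopInvariant.frontier I v∈N = record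
    { grown    = grow grown a∈Vj av v∈V⊥ v-acc
    ; frontier = frontier′
    ; rejected = rejected
    ; closed   = closed′
    }
    where
    open LoopInvariant I
    Vj′ = Vj ∪ ⁅ v ⁆
    Fresh = nbrs G v (V⊥ ─ (U ∪ Vj′))
    Vj⊆ : Vj ⊆ Vj′
    Vj⊆ = p⊆p∪q ⁅ v ⁆
    v∈Vj′ : v ∈ Vj′
    v∈Vj′ = q⊆p∪q Vj ⁅ v ⁆ (x∈⁅x⁆ v)
    frontier′ : y ∈ (N ─ ⁅ v ⁆) ∪ Fresh → y ∈ V⊥ × ∃ λ x → x ∈ Vj′ × adj x y ≡ true
    frontier′ y∈ with x∈p∪q⁻ (N ─ ⁅ v ⁆) Fresh y∈
    ... | inj₁ y∈N =
      let y∈V⊥ , x , x∈Vj , xy = frontier (p─q⊆p N ⁅ v ⁆ y∈N) in y∈V⊥ , x , Vj⊆ x∈Vj , xy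
    ... | inj₂ y∈Fresh = let vy , y∈ = ∈nbrs⁻ _ y∈Fresh in p─q⊆p V⊥ _ y∈ , v , v∈Vj′ , vy
    kept : y ∈ N ⊎ y ∈ U ⊎ y ∈ Vj → y ∈ (N ─ ⁅ v ⁆) ∪ Fresh ⊎ y ∈ U ⊎ y ∈ Vj′
    kept (inj₁ y∈N) with x∈p⇒x∈p-y⊎x≡y v y∈N
    ... | inj₁ y∈N-v = inj₁ (p⊆p∪q Fresh y∈N-v)
    ... | inj₂ refl  = inj₂ (inj₂ v∈Vj′)
    kept (inj₂ (inj₁ y∈U))  = inj₂ (inj₁ y∈U)
    kept (inj₂ (inj₂ y∈Vj)) = inj₂ (inj₂ (Vj⊆ y∈Vj))
    closed′ : u ∈ Vj′ → adj u y ≡ true → y ∈ V⊥ → y ∈ (N ─ ⁅ v ⁆) ∪ Fresh ⊎ y ∈ U ⊎ y ∈ Vj′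
    closed′ {y = y} u∈ uy y∈V⊥ with x∈p∪⁅y⁆⁻ Vj u∈ | y ∈? (U ∪ Vj′)
    ... | inj₁ u∈Vj | _ = kept (closed u∈Vj uy y∈V⊥)
    ... | inj₂ refl | yes y∈U∪Vj′ = inj₂ (x∈p∪q⁻ U Vj′ y∈U∪Vj′)
    ... | inj₂ refl | no y∉U∪Vj′ =
      inj₁ (q⊆p∪q (N ─ ⁅ v ⁆) Fresh (∈nbrs⁺ uy (x∈p∧x∉q⇒x∈p─q y∈V⊥ y∉U∪Vj′)))

  reject-step : LoopInvariant N U Vj → v ∈ N → ¬ Accepts v →
                LoopInvariant (N ─ ⁅ v ⁆) (U ∪ ⁅ v ⁆) Vj
  reject-step {N} {U} {Vj} {v} I v∈N v-rej = record
    { grown    = grown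
    ; frontier = frontier ∘ p─q⊆p N ⁅ v ⁆
    ; rejected = rejected′
    ; closed   = closed′
    }
    where
    open LoopInvariant I
    rejected′ : u ∈ U ∪ ⁅ v ⁆ → ¬ Accepts u
    rejected′ u∈ with x∈p∪⁅y⁆⁻ U u∈
    ... | inj₁ u∈U = rejected u∈U
    ... | inj₂ refl = v-rej
    closed′ : x ∈ Vj → adj x y ≡ true → y ∈ V⊥ → y ∈ N ─ ⁅ v ⁆ ⊎ y ∈ U ∪ ⁅ v ⁆ ⊎ y ∈ Vj
    closed′ x∈Vj xy y∈V⊥ with closed x∈Vj xy y∈V⊥
    ... | inj₁ y∈N with x∈p⇒x∈p-y⊎x≡y v y∈N
    ...   | inj₁ y∈N-v = inj₁ y∈N-v
    ...   | inj₂ refl  = inj₂ (inj₁ (q⊆p∪q U ⁅ v ⁆ (x∈⁅x⁆ v)))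
    closed′ _ _ _ | inj₂ (inj₁ y∈U)  = inj₂ (inj₁ (p⊆p∪q ⁅ v ⁆ y∈U))
    closed′ _ _ _ | inj₂ (inj₂ y∈Vj) = inj₂ (inj₂ y∈Vj)

  initial : LoopInvariant (nbrs G tj V⊥) ⊥ ⁅ tj ⁆
  initial = record
    { grown    = record
      { centre∈ = x∈⁅x⁆ tj ; reaches-centre = reaches-centre ; admitted = inj₁ ∘ x∈⁅y⁆⇒x≡y tj }
    ; frontier = λ v∈N → let tv , v∈V⊥ = ∈nbrs⁻ V⊥ v∈N in v∈V⊥ , tj , x∈⁅x⁆ tj , tv
    ; rejected = λ u∈⊥ → ⊥-elim (∉⊥ u∈⊥)
    ; closed   = closed
    }
    where
    reaches-centre : x ∈ ⁅ tj ⁆ → Σ (Walk G x tj) (WalkIn G ⁅ tj ⁆)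
    reaches-centre x∈ with x∈⁅y⁆⇒x≡y tj x∈
    ... | refl = [] , x∈
    closed : x ∈ ⁅ tj ⁆ → adj x y ≡ true → y ∈ V⊥ → y ∈ nbrs G tj V⊥ ⊎ y ∈ ⊥ ⊎ y ∈ ⁅ tj ⁆
    closed x∈ xy y∈V⊥ with x∈⁅y⁆⇒x≡y tj x∈
    ... | refl = inj₁ (∈nbrs⁺ xy y∈V⊥)

  terminated : LoopInvariant ⊥ U Vj → IsCluster Vj
  terminated {U} {Vj} I = record
    { grown = grown ; closed = λ x∈Vj xy y∈V⊥ → settle (closed x∈Vj xy y∈V⊥) }
    where
    open LoopInvariant I
    settle : y ∈ ⊥ ⊎ y ∈ U ⊎ y ∈ Vj → y ∈ Vj ⊎ ¬ Accepts y
    settle (inj₁ y∈⊥)         = ⊥-elim (∉⊥ y∈⊥)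
    settle (inj₂ (inj₁ y∈U))  = inj₂ (rejected y∈U)
    settle (inj₂ (inj₂ y∈Vj)) = inj₁ y∈Vj

  loop-isCluster : CCRun G d D V⊥ tj R N U Vj res → LoopInvariant N U Vj → IsCluster res
  loop-isCluster done                   I = terminated I
  loop-isCluster (accept v v∈N acc run) I = loop-isCluster run (accept-step I v∈N acc)
  loop-isCluster (reject v v∈N rej run) I = loop-isCluster run (reject-step I v∈N rej)

  createCluster-isCluster : CreateCluster G d D V⊥ tj R res → IsCluster res
  createCluster-isCluster run = loop-isCluster run initial

module NoisyVoronoiProperties
  (F : RealLike) {n k : ℕ} (G : Graphs.WGraph F n)
  (d : Fin n → Fin n → RealLike.ℝ F) (sp : Graphs.IsShortestPathMetric F G d)
  (D : Fin n → RealLike.ℝ F) (t : Fin k → Fin n) (TD : Graphs.IsTerminalDistance F G t d D)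
  (g : Fin k → ℕ) (C : Fin k → Subset n) (run : Graphs.NoisyVoronoiRun F G d D t g C) where
  open RealLike F renaming (_≤_ to _≤ᵣ_)
  open Graphs F
  open WGraph G
  open OrderedFieldProperties F
  open WalkProperties F G
  private variable i j : Fin k; u v x y : Fin n

  R : Fin k → ℝ
  R j = Radius G d D t (g j)

  module Cluster (j : Fin k) = CreateClusterProperties F G d D (Vbot G d D t C j) (t j) (R j)
  open Cluster using (IsCluster)

  cluster : ∀ j → IsCluster j (C j)
  cluster j = Cluster.createCluster-isCluster j (run j)

  module ClusterC (j : Fin k) = Cluster.IsCluster j (cluster j)

  t∈C : ∀ j → t j ∈ C j
  t∈C j = ClusterC.centre∈ j

  ∈Vbot⁻ : y ∈ Vbot G d D t C j → (∀ m → y ≢ t m) × (∀ i → i Fin.< j → y ∉ C i)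
  ∈Vbot⁻ {y} {j} y∈ = not-terminal , not-earlier
    where
    not-terminal : ∀ m → y ≢ t m
    not-terminal m refl = x∈p─q⇒x∉q (p─q⊆p _ _ y∈)
      (∈⋃-map⁺ (λ i → ⁅ t i ⁆) (∈-allFin m) (x∈⁅x⁆ (t m)))
    not-earlier : ∀ i → i Fin.< j → y ∉ C i
    not-earlier i i<j y∈Ci = x∈p─q⇒x∉q y∈
      (∈⋃-map⁺ C (∈-filter⁺ (_<? j) (∈-allFin i) i<j) y∈Ci)

  uncovered⇒∈Vbot : (∀ i → y ∉ C i) → y ∈ Vbot G d D t C j
  uncovered⇒∈Vbot {y} {j} y∉C = x∈p∧x∉q⇒x∈p─q (x∈p∧x∉q⇒x∈p─q ∈⊤ not-terminal) not-earlier
    where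
    not-terminal : y ∉ Kset G d D t
    not-terminal y∈K with ∈⋃-map⁻ (λ i → ⁅ t i ⁆) (allFin k) y∈K
    ... | m , y∈tm rewrite x∈⁅y⁆⇒x≡y (t m) y∈tm = y∉C m (t∈C m)
    not-earlier : y ∉ ⋃ (map C (filter (_<? j) (allFin k)))
    not-earlier y∈⋃ = let m , y∈Cm = ∈⋃-map⁻ C (filter (_<? j) (allFin k)) y∈⋃ in y∉C m y∈Cm

  ∈C⇒≡t⊎∈Vbot : x ∈ C j → x ≡ t j ⊎ x ∈ Vbot G d D t C j
  ∈C⇒≡t⊎∈Vbot {j = j} x∈Cj with ClusterC.admitted j x∈Cj
  ... | inj₁ x≡tj        = inj₁ x≡tj
  ... | inj₂ (x∈Vbot , _) = inj₂ x∈Vbot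

  module _ (t-injective : Injective _≡_ _≡_ t) where

    disjoint-< : i Fin.< j → v ∈ C i → v ∈ C j → i ≡ j
    disjoint-< {i} {j} i<j v∈Ci v∈Cj with ∈C⇒≡t⊎∈Vbot v∈Cj
    ... | inj₂ v∈Vbotj = ⊥-elim (proj₂ (∈Vbot⁻ v∈Vbotj) i i<j v∈Ci)
    ... | inj₁ v≡tj with ∈C⇒≡t⊎∈Vbot v∈Ci
    ...   | inj₁ v≡ti     = t-injective (trans (sym v≡ti) v≡tj)
    ...   | inj₂ v∈Vboti = ⊥-elim (proj₁ (∈Vbot⁻ v∈Vboti) j v≡tj)

    disjoint : v ∈ C i → v ∈ C j → i ≡ j
    disjoint {i = i} {j} v∈Ci v∈Cj with <-cmp i j
    ... | tri< i<j _ _ = disjoint-< i<j v∈Ci v∈Cj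
    ... | tri≈ _ i≡j _ = i≡j
    ... | tri> _ _ j<i = sym (disjoint-< j<i v∈Cj v∈Ci)

  cluster-connected : u ∈ C j → v ∈ C j → Σ (Walk G u v) (WalkIn G (C j))
  cluster-connected {j = j} u∈Cj v∈Cj
    with p , p⊆Cj ← ClusterC.reaches-centre j u∈Cj
       | q , q⊆Cj ← ClusterC.reaches-centre j v∈Cj
    = p ++ reverse q , WalkIn-++ p (reverse q) p⊆Cj (WalkIn-reverse q q⊆Cj)

  d-≤-step : adj y x ≡ true → ∀ z → d y z ≤ᵣ w y x + d x z
  d-≤-step {y} {x} yx z with proj₁ (sp x z)
  ... | p , weight≡d = subst (d y z ≤ᵣ_) (cong (w y x +_) weight≡d) (proj₂ (sp y z) (step yx p))

  D-nonneg : ∀ v → 0ℝ ≤ᵣ D v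
  D-nonneg v with proj₁ (TD v)
  ... | m , Dv≡d with proj₁ (sp v (t m))
  ...   | p , weight≡d = subst (0ℝ ≤ᵣ_) (trans weight≡d (sym Dv≡d)) (weight-nonneg p)

  IsNearestTerminalWalk : Walk G y u → Set
  IsNearestTerminalWalk {y} p = ∀ m → weight G p ≤ᵣ d y (t m)

  nearestTerminalWalk : ∀ v → ∃ λ j → Σ (Walk G v (t j)) IsNearestTerminalWalk
  nearestTerminalWalk v with proj₁ (TD v)
  ... | j , Dv≡d with proj₁ (sp v (t j))
  ...   | p , weight≡d =
    j , p , λ m → subst (_≤ᵣ d v (t m)) (trans Dv≡d (sym weight≡d)) (proj₂ (TD v) m)

  nearest-tail : (yx : adj y x ≡ true) (p : Walk G x u) →
                 IsNearestTerminalWalk (step yx p) → IsNearestTerminalWalk p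
  nearest-tail {y} {x} yx p nearest m =
    +-cancelˡ-≤ (w y x) (≤-trans (nearest m) (d-≤-step yx (t m)))

  nearest-D-step : (yx : adj y x ≡ true) (p : Walk G x (t j)) →
                   IsNearestTerminalWalk (step yx p) → w y x + D x ≤ᵣ D y
  nearest-D-step {y} {x} {j} yx p nearest with proj₁ (TD y)
  ... | m , Dy≡d = begin
    w y x + D x          ∼⟨ +-monoʳ-≤ (w y x) (proj₂ (TD x) j) ⟩
    w y x + d x (t j)    ∼⟨ +-monoʳ-≤ (w y x) (proj₂ (sp x (t j)) p) ⟩
    weight G (step yx p) ∼⟨ nearest m ⟩
    d y (t m)            ≡⟨ Dy≡d ⟨
    D y                  ∎
    where open ≤-Reasoning

  module _ (2≤k : 2 ≤ k) where

    1≤R : ∀ j → 1ℝ ≤ᵣ R j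
    1≤R j = 1≤^ (x≤x+y (δ-nonneg 2≤k)) (g j)

    cluster-accepts : x ∈ C j → Cluster.Accepts j x
    cluster-accepts {x} {j} x∈Cj with ClusterC.admitted j x∈Cj
    ... | inj₂ (_ , x-acc) = x-acc
    ... | inj₁ refl = ≤-trans (proj₂ (sp x x) []) (*-nonneg (≤-trans 0≤1 (1≤R j)) (D-nonneg x))

    neighbour-accepts : x ∈ C j → adj y x ≡ true → w y x + D x ≤ᵣ D y → Cluster.Accepts j y
    neighbour-accepts {x} {j} {y} x∈Cj yx D-step = begin
      d y (t j)             ∼⟨ d-≤-step yx (t j) ⟩
      w y x + d x (t j)     ∼⟨ +-monoʳ-≤ (w y x) (cluster-accepts x∈Cj) ⟩
      w y x + R j * D x     ∼⟨ dilate-+-≤ (1≤R j) (proj₁ (w-pos y x yx)) D-step ⟩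
      R j * D y             ∎
      where open ≤-Reasoning

    covered-by-neighbour : x ∈ C j → adj y x ≡ true → w y x + D x ≤ᵣ D y → ∃ λ i → y ∈ C i
    covered-by-neighbour {x} {j} {y} x∈Cj yx D-step with any? (λ i → y ∈? C i)
    ... | yes y-covered = y-covered
    ... | no y-uncovered
      with ClusterC.closed j x∈Cj (adj-flip yx) (uncovered⇒∈Vbot λ i y∈Ci → y-uncovered (i , y∈Ci))
    ...   | inj₁ y∈Cj    = j , y∈Cj
    ...   | inj₂ y-rejected = ⊥-elim (y-rejected (neighbour-accepts x∈Cj yx D-step))

    covered-along : (p : Walk G y (t j)) → IsNearestTerminalWalk p → ∃ λ i → y ∈ C i
    covered-along {j = j} []         _       = j , t∈C j
    covered-along         (step yx p) nearest =
      covered-by-neighbour (proj₂ (covered-along p (nearest-tail yx p nearest)))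
                           yx (nearest-D-step yx p nearest)

    covered : ∀ v → ∃ λ i → v ∈ C i
    covered v = let _ , p , nearest = nearestTerminalWalk v in covered-along p nearest

lemma3 : (F : RealLike) → let open RealLike F using (ℝ) in let open Graphs F in
    ∀ {n k : ℕ} (G : WGraph n) → Connected G →
    2 ≤ k → (t : Fin k → Fin n) → Injective _≡_ _≡_ t →
    (d : Fin n → Fin n → ℝ) → IsShortestPathMetric G d →
    (D : Fin n → ℝ) → IsTerminalDistance G t d D →
    (g : Fin k → ℕ) → (∀ j → 1 ≤ g j) →
    (C : Fin k → Subset n) → NoisyVoronoiRun G d D t g C →
    IsTerminalPartition G d D t C
lemma3 F G _ 2≤k t t-injective d sp D TD g _ C run =
  t∈C , covered 2≤k , (λ _ _ _ → disjoint t-injective) , (λ _ _ _ → cluster-connected)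
  where open NoisyVoronoiProperties F G d sp D t TD g C run
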